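{- Let $L'$ and $L$ be layers in a layered labelled sequent $G$, and let $S$ be a layer simulation between $L'$ and $L$. Then for every $x\in L$ there is $x'\in L'$ such that $x'\,S\,x$.
   Context: A labelled sequent $G$ is $\mathcal{R},\Gamma\Rightarrow\Delta$ with $\mathcal{R}$ a set of relational atoms $xRy$ or $x\le y$ between labels and $\Gamma,\Delta$ multisets of labelled formulas $x{:}A$; write $x\le_G y$, $xR_Gy$ when the atom is in $\mathcal{R}$. A layer of $G$ is an equivalence class of the reflexive transitive closure of $R_G\cup R_G^{ -1}$. $G$ is layered iff for all labels $x,x',y,y'$: (1) if $xR_Gy$ and $x\neq y$ then neither $x\le_Gy$ nor $y\le_Gx$; (2) if $xR_Gy$, $x'R_Gy'$, $x\le_Gx'$ and $x\neq x'$, then not $y'\le_G y$. Labels $x,y$ are equivalent, $x\sim y$, iff for every formula $A$, $x{:}A\in\Gamma \Leftrightarrow y{:}A\in\Gamma$ and $x{:}A\in\Delta\Leftrightarrow y{:}A\in\Delta$. A layer simulation between $L'$ and $L$ is a non-empty relation $S\subseteq (L'\times L)\cap{\sim}$ such that for all $x'\in L'$, $x,y\in L$: (S1) if $x'Sx$ and $xR_Gy$ then there is $y'\in L'$ with $x'R_Gy'$ and $y'Sy$; (S2) if $x'Sx$ and $yR_Gx$ then there is $y'\in L'$ with $y'R_Gx'$ and $y'Sy$. -}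

module Defs where

open import Data.List using (List)
open import Data.List.Membership.Propositional using (_∈_)
open import Data.Product using (Σ; ∃; ∃-syntax; _×_; _,_)
open import Data.Sum using (_⊎_)
open import Relation.Binary.PropositionalEquality using (_≡_)
open import Relation.Nullary using (¬_)
open import Relation.Binary.Construct.Closure.ReflexiveTransitive using (Star)
open import Relation.Binary.Construct.Closure.Symmetric using (SymClosure)

module _ (Label : Set) (Formula : Set) where

  data RelAtom : Set where
    rel : Label → Label → RelAtom
    leq : Label → Label → RelAtom

  LFormula : Set
  LFormula = Label × Formula

  -- a labelled sequent  R, Γ ⇒ Δ  (finite; multisets represented by lists)
  record Sequent : Set where
    constructor _,_⇒_
    field
      atoms : List RelAtom
      ante  : List LFormula
      succ  : List LFormula
  open Sequent public

  module _ (G : Sequent) where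

    _R_ : Label → Label → Set
    x R y = rel x y ∈ atoms G

    _≤G_ : Label → Label → Set
    x ≤G y = leq x y ∈ atoms G

    data Occurs (x : Label) : Set where
      in-rel₁ : ∀ {y} → rel x y ∈ atoms G → Occurs x
      in-rel₂ : ∀ {y} → rel y x ∈ atoms G → Occurs x
      in-leq₁ : ∀ {y} → leq x y ∈ atoms G → Occurs x
      in-leq₂ : ∀ {y} → leq y x ∈ atoms G → Occurs x
      in-ante : ∀ {A} → (x , A) ∈ ante G → Occurs x
      in-succ : ∀ {A} → (x , A) ∈ succ G → Occurs x

    Connected : Label → Label → Set
    Connected = Star (SymClosure _R_)

    IsLayer : (Label → Set) → Set
    IsLayer L = ∃[ x₀ ] (Occurs x₀ × (∀ y → (L y → Connected x₀ y) × (Connected x₀ y → L y)))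

    Layered : Set
    Layered =
      (∀ x y → x R y → ¬ (x ≡ y) → ¬ (x ≤G y) × ¬ (y ≤G x)) ×
      (∀ x x' y y' → x R y → x' R y' → x ≤G x' → ¬ (x ≡ x') → ¬ (y' ≤G y))

    _∼_ : Label → Label → Set
    x ∼ y = ∀ (A : Formula) →
      (((x , A) ∈ ante G → (y , A) ∈ ante G) × ((y , A) ∈ ante G → (x , A) ∈ ante G)) ×
      (((x , A) ∈ succ G → (y , A) ∈ succ G) × ((y , A) ∈ succ G → (x , A) ∈ succ G))

    IsLayerSimulation : (L' L : Label → Set) → (Label → Label → Set) → Set
    IsLayerSimulation L' L S =
      (∃[ x' ] ∃[ x ] S x' x) ×
      (∀ x' x → S x' x → (L' x' × L x) × (x' ∼ x)) ×
      (∀ x' x y → L' x' → L x → L y → S x' x → x R y →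
         ∃[ y' ] (L' y' × x' R y' × S y' y)) ×
      (∀ x' x y → L' x' → L x → L y → S x' x → y R x →
         ∃[ y' ] (L' y' × y' R x' × S y' y))

module Submission where

-- Any x ∈ L is connected to the second component x₀ of some pair of S.  Both
-- simulation clauses (S1)/(S2) lift each step of such a path, in either
-- direction, to L', so following the path transports the pair to one ending in x.

open import Defs
open import Data.Product using (∃-syntax; _×_; _,_; proj₁; proj₂)
open import Relation.Binary.Construct.Closure.ReflexiveTransitive using (ε; _◅_; _◅◅_; reverse)
open import Relation.Binary.Construct.Closure.Symmetric using (SymClosure; fwd; bwd; symmetric)

module _ {Label Formula : Set} (G : Sequent Label Formula) where

  private
    Step : Label → Label → Set
    Step = SymClosure (_R_ Label Formula G)

  layer-connected : ∀ {L x y} → IsLayer Label Formula G L → L x → L y →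
                    Connected Label Formula G x y
  layer-connected (_ , _ , lay) lx ly =
    reverse (symmetric _) (proj₁ (lay _) lx) ◅◅ proj₁ (lay _) ly

  layer-step-closed : ∀ {L y z} → IsLayer Label Formula G L → L y → Step y z → L z
  layer-step-closed (_ , _ , lay) ly step = proj₂ (lay _) (proj₁ (lay _) ly ◅◅ step ◅ ε)

  simulated-along : ∀ {L' L S y x} → IsLayer Label Formula G L →
                    IsLayerSimulation Label Formula G L' L S → L y →
                    Connected Label Formula G y x →
                    ∃[ y' ] (L' y' × S y' y) → ∃[ x' ] (L' x' × S x' x)
  simulated-along layer sim ly ε simulated = simulated
  simulated-along layer sim@(_ , _ , forth , _) ly (step@(fwd yRz) ◅ path) (y' , ly' , sy'y)
    with forth y' _ _ ly' ly (layer-step-closed layer ly step) sy'y yRz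
  ... | z' , lz' , _ , sz'z =
    simulated-along layer sim (layer-step-closed layer ly step) path (z' , lz' , sz'z)
  simulated-along layer sim@(_ , _ , _ , back) ly (step@(bwd zRy) ◅ path) (y' , ly' , sy'y)
    with back y' _ _ ly' ly (layer-step-closed layer ly step) sy'y zRy
  ... | z' , lz' , _ , sz'z =
    simulated-along layer sim (layer-step-closed layer ly step) path (z' , lz' , sz'z)

mainTheorem5 : (Label Formula : Set) (G : Sequent Label Formula) →
    Layered Label Formula G →
    (L' L : Label → Set) → IsLayer Label Formula G L' → IsLayer Label Formula G L →
    (S : Label → Label → Set) → IsLayerSimulation Label Formula G L' L S →
    ∀ x → L x → ∃[ x' ] (L' x' × S x' x)
mainTheorem5 Label Formula G _ L' L _ layer S sim@((x₀' , x₀ , s₀) , related , _) x lx =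
  simulated-along G layer sim lx₀ (layer-connected G layer lx₀ lx) (x₀' , lx₀' , s₀)
  where
  lx₀' : L' x₀'
  lx₀' = proj₁ (proj₁ (related x₀' x₀ s₀))

  lx₀ : L x₀
  lx₀ = proj₂ (proj₁ (related x₀' x₀ s₀))
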